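{- For all labels $X\supseteq Y$, every formula $\varphi$ and all finite multisets $\Gamma,\Delta$ of labelled formulas: if $Y:\varphi,\Gamma\Rightarrow\Delta$ is derivable in $\mathbf{G}(\mathsf{FBInqBQ})$, then $X:\varphi,\Gamma\Rightarrow\Delta$ is derivable in $\mathbf{G}(\mathsf{FBInqBQ})$.
   Context: Language: countably infinite set of variables, countably infinite set of predicate symbols with arities (no identity, constants, function symbols). Formulas: $\varphi ::= P(x_1,\dots,x_m)\mid \bot\mid \varphi\to\varphi\mid\varphi\wedge\varphi\mid \varphi\veebar\varphi\mid \forall x\varphi\mid \bar\exists x\varphi$ ($\veebar$ inquisitive disjunction, $\bar\exists$ inquisitive existential). $\varphi[z/x]$ is capture-avoiding substitution. Calculus $\mathbf{G}(\mathsf{FBInqBQ})$: a label is a nonempty finite subset of $\omega$; a labelled formula is $X:\varphi$ with $X$ a label; a sequent $\Gamma\Rightarrow\Delta$ is a pair of finite multisets of labelled formulas. $X,Y$ range over labels. Initial sequents: $(\mathtt{id})$ $X:P(\bar x),\Gamma\Rightarrow\Delta,Y:P(\bar x)$ whenever $X\supseteq Y$; $(\bot\Rightarrow)$ $X:\bot,\Gamma\Rightarrow\Delta$. Rules (premises / conclusion): $(\Rightarrow\mathtt{at})$: $\Gamma\Rightarrow\Delta,\{k\}:P(\bar x)$ for every $k\in X$ / $\Gamma\Rightarrow\Delta,X:P(\bar x)$. $(\Rightarrow\wedge)$: $\Gamma\Rightarrow\Delta,X:\varphi$ and $\Gamma\Rightarrow\Delta,X:\psi$ / $\Gamma\Rightarrow\Delta,X:\varphi\wedge\psi$.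 $(\wedge\Rightarrow)$: $X:\varphi,X:\psi,\Gamma\Rightarrow\Delta$ / $X:\varphi\wedge\psi,\Gamma\Rightarrow\Delta$. $(\Rightarrow\veebar)$: $\Gamma\Rightarrow\Delta,X:\varphi,X:\psi$ / $\Gamma\Rightarrow\Delta,X:\varphi\veebar\psi$. $(\veebar\Rightarrow)$: $X:\varphi,\Gamma\Rightarrow\Delta$ and $X:\psi,\Gamma\Rightarrow\Delta$ / $X:\varphi\veebar\psi,\Gamma\Rightarrow\Delta$. $(\Rightarrow\to)$: $Y:\varphi,\Gamma\Rightarrow\Delta,Y:\psi$ for every label $Y\subseteq X$ / $\Gamma\Rightarrow\Delta,X:\varphi\to\psi$. $(\to\Rightarrow)$, for a label $Y\subseteq X$: $X:\varphi\to\psi,\Gamma\Rightarrow\Delta,Y:\varphi$ and $Y:\psi,X:\varphi\to\psi,\Gamma\Rightarrow\Delta$ / $X:\varphi\to\psi,\Gamma\Rightarrow\Delta$. $(\Rightarrow\forall)$: $\Gamma\Rightarrow\Delta,X:\varphi[z/x]$ / $\Gamma\Rightarrow\Delta,X:\forall x\varphi$, with $z$ not occurring in the conclusion. $(\forall\Rightarrow)$: $X:\varphi[y/x],X:\forall x\varphi,\Gamma\Rightarrow\Delta$ / $X:\forall x\varphi,\Gamma\Rightarrow\Delta$ ($y$ arbitrary). $(\Rightarrow\bar\exists)$: $\Gamma\Rightarrow\Delta,X:\bar\exists x\varphi,X:\varphi[y/x]$ / $\Gamma\Rightarrow\Delta,X:\bar\exists x\varphi$ ($y$ arbitrary). $(\bar\exists\Rightarrow)$: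 $X:\varphi[z/x],\Gamma\Rightarrow\Delta$ / $X:\bar\exists x\varphi,\Gamma\Rightarrow\Delta$, with $z$ not occurring in the conclusion. A derivation is a finite tree of sequents built from initial sequents by these rules; a sequent is derivable if it is the root of a derivation. -}

module Defs where

open import Data.Nat using (ℕ; _<_) renaming (suc to sucℕ)
open import Data.Fin using (Fin; zero; suc)
open import Data.List using (List; []; _∷_; _++_; concatMap; [_])
open import Data.List.Relation.Unary.Linked using (Linked; [-])
open import Data.List.Membership.Propositional using (_∈_; _∉_)
open import Data.List.Relation.Binary.Permutation.Propositional using (_↭_)
open import Data.Vec using (Vec; toList) renaming (map to vmap)
open import Relation.Binary.PropositionalEquality using (_≡_; _≢_)

-- Free variables are named by natural numbers; variables bound by a
-- quantifier are de Bruijn indices, so formulas are identified up to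
-- α-equivalence and substitution is automatically capture-avoiding.
-- Formula n : formulas with n enclosing binders; the formulas of the
-- language are Formula 0.

data Term (n : ℕ) : Set where
  bvar : Fin n → Term n
  fvar : ℕ → Term n

infixr 6 _∧'_
infixr 5 _⩒_
infixr 4 _⟶_

-- predicate symbols: pairs (p , m) with m the arity
data Formula (n : ℕ) : Set where
  atom : (p m : ℕ) → Vec (Term n) m → Formula n
  ⊥'   : Formula n
  _⟶_  : Formula n → Formula n → Formula n
  _∧'_ : Formula n → Formula n → Formula n
  _⩒_  : Formula n → Formula n → Formula n
  ∀'   : Formula (sucℕ n) → Formula n
  ∃̄    : Formula (sucℕ n) → Formula n

Subst : ℕ → ℕ → Set
Subst n m = Fin n → Term m

wkT : ∀ {m} → Term m → Term (sucℕ m)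
wkT (bvar i) = bvar (suc i)
wkT (fvar x) = fvar x

lift : ∀ {n m} → Subst n m → Subst (sucℕ n) (sucℕ m)
lift σ zero    = bvar zero
lift σ (suc i) = wkT (σ i)

substT : ∀ {n m} → Subst n m → Term n → Term m
substT σ (bvar i) = σ i
substT σ (fvar x) = fvar x

substF : ∀ {n m} → Subst n m → Formula n → Formula m
substF σ (atom p k ts) = atom p k (vmap (substT σ) ts)
substF σ ⊥'        = ⊥'
substF σ (φ ⟶ ψ)   = substF σ φ ⟶ substF σ ψ
substF σ (φ ∧' ψ)  = substF σ φ ∧' substF σ ψ
substF σ (φ ⩒ ψ)   = substF σ φ ⩒ substF σ ψ
substF σ (∀' φ)    = ∀' (substF (lift σ) φ)
substF σ (∃̄ φ)     = ∃̄ (substF (lift σ) φ)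

_[_/x] : Formula 1 → ℕ → Formula 0
φ [ y /x] = substF (λ _ → fvar y) φ

varsT : ∀ {n} → Term n → List ℕ
varsT (bvar _) = []
varsT (fvar x) = [ x ]

vars : ∀ {n} → Formula n → List ℕ
vars (atom p k ts) = concatMap varsT (toList ts)
vars ⊥'        = []
vars (φ ⟶ ψ)   = vars φ ++ vars ψ
vars (φ ∧' ψ)  = vars φ ++ vars ψ
vars (φ ⩒ ψ)   = vars φ ++ vars ψ
vars (∀' φ)    = vars φ
vars (∃̄ φ)     = vars φ

-- Labels: nonempty finite subsets of ω, represented canonically as
-- strictly increasing nonempty lists.

record Label : Set where
  constructor label
  field
    elems    : List ℕ
    sorted   : Linked _<_ elems
    nonempty : elems ≢ []

_∈L_ : ℕ → Label → Set
k ∈L X = k ∈ Label.elems X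

_⊆L_ : Label → Label → Set
Y ⊆L X = ∀ {k} → k ∈L Y → k ∈L X

｛_｝ : ℕ → Label
｛ k ｝ = label [ k ] [-] (λ ())

-- Labelled formulas and sequents.  Finite multisets are lists taken up
-- to permutation: every rule accepts any permutation of the
-- displayed conclusion (principal formula in front).

infix 2 _▸_
data LFormula : Set where
  _▸_ : Label → Formula 0 → LFormula

varsLF : LFormula → List ℕ
varsLF (X ▸ φ) = vars φ

varsS : List LFormula → List LFormula → List ℕ
varsS Γ Δ = concatMap varsLF Γ ++ concatMap varsLF Δ

infix 1 _⇒_
data _⇒_ : List LFormula → List LFormula → Set where
  id   : ∀ {Γ Δ Γ' Δ' X Y p m xs} →
         Γ ↭ (X ▸ atom p m xs) ∷ Γ' → Δ ↭ (Y ▸ atom p m xs) ∷ Δ' →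
         Y ⊆L X → Γ ⇒ Δ
  ⊥⇒   : ∀ {Γ Δ Γ' X} → Γ ↭ (X ▸ ⊥') ∷ Γ' → Γ ⇒ Δ
  ⇒at  : ∀ {Γ Δ Δ' X p m xs} → Δ ↭ (X ▸ atom p m xs) ∷ Δ' →
         (∀ {k} → k ∈L X → Γ ⇒ (｛ k ｝ ▸ atom p m xs) ∷ Δ') → Γ ⇒ Δ
  ⇒∧   : ∀ {Γ Δ Δ' X φ ψ} → Δ ↭ (X ▸ φ ∧' ψ) ∷ Δ' →
         Γ ⇒ (X ▸ φ) ∷ Δ' → Γ ⇒ (X ▸ ψ) ∷ Δ' → Γ ⇒ Δ
  ∧⇒   : ∀ {Γ Δ Γ' X φ ψ} → Γ ↭ (X ▸ φ ∧' ψ) ∷ Γ' →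
         (X ▸ φ) ∷ (X ▸ ψ) ∷ Γ' ⇒ Δ → Γ ⇒ Δ
  ⇒⩒   : ∀ {Γ Δ Δ' X φ ψ} → Δ ↭ (X ▸ φ ⩒ ψ) ∷ Δ' →
         Γ ⇒ (X ▸ φ) ∷ (X ▸ ψ) ∷ Δ' → Γ ⇒ Δ
  ⩒⇒   : ∀ {Γ Δ Γ' X φ ψ} → Γ ↭ (X ▸ φ ⩒ ψ) ∷ Γ' →
         (X ▸ φ) ∷ Γ' ⇒ Δ → (X ▸ ψ) ∷ Γ' ⇒ Δ → Γ ⇒ Δ
  ⇒⟶   : ∀ {Γ Δ Δ' X φ ψ} → Δ ↭ (X ▸ φ ⟶ ψ) ∷ Δ' →
         ((Y : Label) → Y ⊆L X → (Y ▸ φ) ∷ Γ ⇒ (Y ▸ ψ) ∷ Δ') → Γ ⇒ Δ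
  ⟶⇒   : ∀ {Γ Δ Γ' X Y φ ψ} → Γ ↭ (X ▸ φ ⟶ ψ) ∷ Γ' → Y ⊆L X →
         Γ ⇒ (Y ▸ φ) ∷ Δ → (Y ▸ ψ) ∷ Γ ⇒ Δ → Γ ⇒ Δ
  ⇒∀   : ∀ {Γ Δ Δ' X φ z} → Δ ↭ (X ▸ ∀' φ) ∷ Δ' → z ∉ varsS Γ Δ →
         Γ ⇒ (X ▸ φ [ z /x]) ∷ Δ' → Γ ⇒ Δ
  ∀⇒   : ∀ {Γ Δ Γ' X φ} y → Γ ↭ (X ▸ ∀' φ) ∷ Γ' →
         (X ▸ φ [ y /x]) ∷ Γ ⇒ Δ → Γ ⇒ Δ
  ⇒∃̄   : ∀ {Γ Δ Δ' X φ} y → Δ ↭ (X ▸ ∃̄ φ) ∷ Δ' →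
         Γ ⇒ (X ▸ φ [ y /x]) ∷ Δ → Γ ⇒ Δ
  ∃̄⇒   : ∀ {Γ Δ Γ' X φ z} → Γ ↭ (X ▸ ∃̄ φ) ∷ Γ' → z ∉ varsS Γ Δ →
         (X ▸ φ [ z /x]) ∷ Γ' ⇒ Δ → Γ ⇒ Δ

{-# OPTIONS --safe #-}
module Submission where

-- The only rules that inspect the label of an
-- antecedent formula are (id) and (→⇒), whose side conditions Y ⊆ X survive
-- enlarging X; the eigenvariable conditions are untouched because labels carry
-- no variables.  Since every rule acts up to permutation, the enlargement has
-- to be transported along the permutation exposing the principal formula.

open import Defs
open import Data.List using (List; _∷_; _++_; concat)
open import Data.List.Membership.Propositional using (_∉_)
open import Data.List.Relation.Binary.Permutation.Propositional
  using (_↭_; refl; prep; swap; trans)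
open import Data.List.Relation.Binary.Pointwise as Pointwise
  using (Pointwise; []; _∷_; map⁺; Pointwise-≡⇒≡)
open import Data.Product using (∃; ∃₂; _×_; _,_)
open import Function using (_∘_)
open import Relation.Binary.Core using (REL)
open import Relation.Binary.PropositionalEquality as ≡ using (_≡_; cong; subst)

Pointwise-↭ : ∀ {a b ℓ} {A : Set a} {B : Set b} {R : REL A B ℓ} {xs zs : List A} {ys : List B} →
              Pointwise R xs ys → xs ↭ zs → ∃ λ ws → Pointwise R zs ws × ys ↭ ws
Pointwise-↭ rs refl = _ , rs , refl
Pointwise-↭ (r ∷ rs) (prep _ p) with Pointwise-↭ rs p
... | _ , rs′ , p′ = _ , r ∷ rs′ , prep _ p′
Pointwise-↭ (r ∷ s ∷ rs) (swap _ _ p) with Pointwise-↭ rs p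
... | _ , rs′ , p′ = _ , s ∷ r ∷ rs′ , swap _ _ p′
Pointwise-↭ rs (trans p q) with Pointwise-↭ rs p
... | _ , rs₁ , p′ with Pointwise-↭ rs₁ q
... | _ , rs₂ , q′ = _ , rs₂ , trans p′ q′

infix 4 _⊑_ _⊑*_

data _⊑_ : LFormula → LFormula → Set where
  ⊆⇒⊑ : ∀ {X Y φ} → Y ⊆L X → (Y ▸ φ) ⊑ (X ▸ φ)

_⊑*_ : List LFormula → List LFormula → Set
_⊑*_ = Pointwise _⊑_

⊑-refl : ∀ {A} → A ⊑ A
⊑-refl {X ▸ φ} = ⊆⇒⊑ (λ k∈X → k∈X)

⊑*-refl : ∀ {Γ} → Γ ⊑* Γ
⊑*-refl = Pointwise.refl ⊑-refl

⊑-varsLF : ∀ {A B} → A ⊑ B → varsLF A ≡ varsLF B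
⊑-varsLF (⊆⇒⊑ _) = ≡.refl

⊑*-varsS : ∀ {Γ Γ′} Δ → Γ ⊑* Γ′ → varsS Γ Δ ≡ varsS Γ′ Δ
⊑*-varsS Δ Γ⊑Γ′ =
  cong (λ vs → concat vs ++ _) (Pointwise-≡⇒≡ (map⁺ varsLF varsLF (Pointwise.map ⊑-varsLF Γ⊑Γ′)))

⊑*-fresh : ∀ {z Γ Γ′} Δ → Γ ⊑* Γ′ → z ∉ varsS Γ Δ → z ∉ varsS Γ′ Δ
⊑*-fresh {z} Δ Γ⊑Γ′ = subst (λ vs → z ∉ vs) (⊑*-varsS Δ Γ⊑Γ′)

⊑*-principal : ∀ {Γ Γ′ Γ₀ X φ} → Γ ⊑* Γ′ → Γ ↭ (X ▸ φ) ∷ Γ₀ →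
               ∃₂ λ X′ Γ₀′ → X ⊆L X′ × Γ₀ ⊑* Γ₀′ × Γ′ ↭ (X′ ▸ φ) ∷ Γ₀′
⊑*-principal Γ⊑Γ′ p with Pointwise-↭ Γ⊑Γ′ p
... | _ , ⊆⇒⊑ X⊆X′ ∷ Γ₀⊑Γ₀′ , p′ = _ , _ , X⊆X′ , Γ₀⊑Γ₀′ , p′

⇒-monoˡ-⊑* : ∀ {Γ Γ′ Δ} → Γ ⇒ Δ → Γ ⊑* Γ′ → Γ′ ⇒ Δ
⇒-monoˡ-⊑* (id p q Y⊆X) Γ⊑Γ′ with ⊑*-principal Γ⊑Γ′ p
... | _ , _ , X⊆X′ , _ , p′ = id p′ q (X⊆X′ ∘ Y⊆X)
⇒-monoˡ-⊑* (⊥⇒ p) Γ⊑Γ′ with ⊑*-principal Γ⊑Γ′ p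
... | _ , _ , _ , _ , p′ = ⊥⇒ p′
⇒-monoˡ-⊑* (⇒at q ds) Γ⊑Γ′ = ⇒at q (λ k∈X → ⇒-monoˡ-⊑* (ds k∈X) Γ⊑Γ′)
⇒-monoˡ-⊑* (⇒∧ q d e) Γ⊑Γ′ = ⇒∧ q (⇒-monoˡ-⊑* d Γ⊑Γ′) (⇒-monoˡ-⊑* e Γ⊑Γ′)
⇒-monoˡ-⊑* (∧⇒ p d) Γ⊑Γ′ with ⊑*-principal Γ⊑Γ′ p
... | _ , _ , X⊆X′ , Γ₀⊑Γ₀′ , p′ = ∧⇒ p′ (⇒-monoˡ-⊑* d (⊆⇒⊑ X⊆X′ ∷ ⊆⇒⊑ X⊆X′ ∷ Γ₀⊑Γ₀′))
⇒-monoˡ-⊑* (⇒⩒ q d) Γ⊑Γ′ = ⇒⩒ q (⇒-monoˡ-⊑* d Γ⊑Γ′)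
⇒-monoˡ-⊑* (⩒⇒ p d e) Γ⊑Γ′ with ⊑*-principal Γ⊑Γ′ p
... | _ , _ , X⊆X′ , Γ₀⊑Γ₀′ , p′ =
  ⩒⇒ p′ (⇒-monoˡ-⊑* d (⊆⇒⊑ X⊆X′ ∷ Γ₀⊑Γ₀′)) (⇒-monoˡ-⊑* e (⊆⇒⊑ X⊆X′ ∷ Γ₀⊑Γ₀′))
⇒-monoˡ-⊑* (⇒⟶ q ds) Γ⊑Γ′ = ⇒⟶ q (λ Y Y⊆X → ⇒-monoˡ-⊑* (ds Y Y⊆X) (⊑-refl ∷ Γ⊑Γ′))
⇒-monoˡ-⊑* (⟶⇒ p Y⊆X d e) Γ⊑Γ′ with ⊑*-principal Γ⊑Γ′ p
... | _ , _ , X⊆X′ , _ , p′ =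
  ⟶⇒ p′ (X⊆X′ ∘ Y⊆X) (⇒-monoˡ-⊑* d Γ⊑Γ′) (⇒-monoˡ-⊑* e (⊑-refl ∷ Γ⊑Γ′))
⇒-monoˡ-⊑* {Δ = Δ} (⇒∀ q z∉ d) Γ⊑Γ′ = ⇒∀ q (⊑*-fresh Δ Γ⊑Γ′ z∉) (⇒-monoˡ-⊑* d Γ⊑Γ′)
⇒-monoˡ-⊑* (∀⇒ y p d) Γ⊑Γ′ with ⊑*-principal Γ⊑Γ′ p
... | _ , _ , X⊆X′ , _ , p′ = ∀⇒ y p′ (⇒-monoˡ-⊑* d (⊆⇒⊑ X⊆X′ ∷ Γ⊑Γ′))
⇒-monoˡ-⊑* (⇒∃̄ y q d) Γ⊑Γ′ = ⇒∃̄ y q (⇒-monoˡ-⊑* d Γ⊑Γ′)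
⇒-monoˡ-⊑* {Δ = Δ} (∃̄⇒ p z∉ d) Γ⊑Γ′ with ⊑*-principal Γ⊑Γ′ p
... | _ , _ , X⊆X′ , Γ₀⊑Γ₀′ , p′ =
  ∃̄⇒ p′ (⊑*-fresh Δ Γ⊑Γ′ z∉) (⇒-monoˡ-⊑* d (⊆⇒⊑ X⊆X′ ∷ Γ₀⊑Γ₀′))

corollary3 : (X Y : Label) → Y ⊆L X → (φ : Formula 0) → (Γ Δ : List LFormula) →
    (Y ▸ φ) ∷ Γ ⇒ Δ → (X ▸ φ) ∷ Γ ⇒ Δ
corollary3 X Y Y⊆X φ Γ Δ d = ⇒-monoˡ-⊑* d (⊆⇒⊑ Y⊆X ∷ ⊑*-refl)
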